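{- Consider the operation $\Upsilon$ on objects $(V,P)$ of $\mathcal P$ whose underlying set $V$ consists of finite sets, defined by $\Upsilon(V,P)=(\upsilon(V),\{\upsilon(p):p\in P\})$ where $\upsilon(X)=\bigcup_{x\in X}x$. There is no way to assign to each morphism $f:A\to B$ in $\mathcal P$ between such objects a morphism $\Upsilon(f):\Upsilon(A)\to\Upsilon(B)$ in $\mathcal P$ such that both of the following hold: $\Upsilon$ becomes a functor, and $\Upsilon(f)_*(x)=f(x)$ for every element $x$ of the underlying set of $A$ and every such morphism $f$.
   Context: $\mathcal P$ is the category with objects $(V,P)$, where $V$ is a finite set and $P\subseteq 2^V$ is a set of parts (not necessarily disjoint or covering). Its morphisms $(V,P)\to(W,Q)$ are functions $f:V\to W$ such that for every $p\in P$ there is $q\in Q$ with $f_*(p)\subseteq q$. For a function $g$, $g_*$ denotes the induced map on subsets, $g_*(A)=g(A)$. -}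

module Defs where

open import Data.Nat using (ℕ)
open import Data.List using (List)
open import Data.List.Membership.Propositional using (_∈_)
open import Data.Fin using (Fin)
open import Data.Fin.Subset using (Subset) renaming (_∈_ to _∈ₛ_)
open import Data.Product using (Σ; ∃-syntax; _×_)
open import Relation.Binary.PropositionalEquality using (_≡_)
open import Function using (_∘_; id)

-- Finite sets of atoms (atoms are natural numbers) are represented by lists;
-- two lists denote the same finite set when they have the same members.
_≐_ : List ℕ → List ℕ → Set
xs ≐ ys = ∀ a → (a ∈ xs → a ∈ ys) × (a ∈ ys → a ∈ xs)

-- V is enumerated without repetition as elt 0 , … , elt (size - 1)
-- (distinct indices denote distinct finite sets), and P ⊆ 2^V is given
-- as a list of subsets of the index set.
record Obj : Set where
  field
    size    : ℕ
    elt     : Fin size → List ℕ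
    elt-inj : ∀ i j → elt i ≐ elt j → i ≡ j
    parts   : List (Subset size)

open Obj public

IsMor : (A B : Obj) → (Fin (size A) → Fin (size B)) → Set
IsMor A B f =
  ∀ p → p ∈ parts A → ∃[ q ] (q ∈ parts B × (∀ i → i ∈ₛ p → f i ∈ₛ q))

InUnion : (A : Obj) → ℕ → Set
InUnion A a = ∃[ i ] (a ∈ elt A i)

InPart : (A : Obj) → Subset (size A) → ℕ → Set
InPart A p a = ∃[ i ] (i ∈ₛ p × a ∈ elt A i)

-- g (a function on atoms, only its values on υ(V_A) matter) is a morphism
-- Υ(A) → Υ(B) of 𝒫, where Υ(V,P) = (υ(V), {υ(p) : p ∈ P}).
IsΥMor : (A B : Obj) → (ℕ → ℕ) → Set
IsΥMor A B g =
  (∀ a → InUnion A a → InUnion B (g a)) ×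
  (∀ p → p ∈ parts A →
     ∃[ q ] (q ∈ parts B × (∀ a → InPart A p a → InPart B q (g a))))

ImageIs : (ℕ → ℕ) → List ℕ → List ℕ → Set
ImageIs g x y = ∀ b → (b ∈ y → ∃[ a ] (a ∈ x × g a ≡ b))
                    × ((∃[ a ] (a ∈ x × g a ≡ b)) → b ∈ y)

-- An assignment f ↦ Υ(f) making Υ a functor and satisfying Υ(f)_*(x) = f(x).
-- Equalities of maps Υ(A) → Υ(B) are pointwise on υ(V_A).
record ΥFunctor : Set where
  field
    Υ      : (A B : Obj) (f : Fin (size A) → Fin (size B)) → IsMor A B f → ℕ → ℕ
    isMor  : ∀ A B f (pf : IsMor A B f) → IsΥMor A B (Υ A B f pf)
    pres-id : ∀ A (pid : IsMor A A id) a → InUnion A a → Υ A A id pid a ≡ a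
    pres-∘ : ∀ A B C (f : Fin (size A) → Fin (size B)) (g : Fin (size B) → Fin (size C))
               (pf : IsMor A B f) (pg : IsMor B C g) (pgf : IsMor A C (g ∘ f))
               a → InUnion A a →
               Υ A C (g ∘ f) pgf a ≡ Υ B C g pg (Υ A B f pf a)
    image  : ∀ A B f (pf : IsMor A B f) (i : Fin (size A)) →
               ImageIs (Υ A B f pf) (elt A i) (elt B (f i))

{-# OPTIONS --safe #-}
module Submission where

-- If two elements of V_A
-- share an atom a while f sends them to disjoint sets, then Υ(f)(a) would have
-- to lie in both images. Such an f exists already between two part-free
-- objects, {{0}, {0,1}} → {{2}, {3}}.

open import Defs
open import Relation.Nullary using (¬_)
open import Data.Empty using (⊥; ⊥-elim)
open import Data.Nat using (ℕ)
open import Data.List using (List; []; _∷_)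
open import Data.List.Membership.Propositional using (_∈_; _∉_)
open import Data.List.Membership.Propositional.Properties using (∉[])
open import Data.List.Relation.Binary.Disjoint.Propositional using (Disjoint)
open import Data.List.Relation.Unary.Any using (here; there)
open import Data.Fin using (Fin; zero; suc)
open import Data.Product using (_,_; proj₁; proj₂)
open import Relation.Binary.PropositionalEquality using (_≡_; refl; subst)
open import Function using (id)

image-∈ : ∀ {g x y a} → ImageIs g x y → a ∈ x → g a ∈ y
image-∈ {a = a} img a∈x = proj₂ (img _) (a , a∈x , refl)

ImageIs-overlapping-disjoint : ∀ {g x x′ y y′ a} → a ∈ x → a ∈ x′ →
  Disjoint y y′ → ImageIs g x y → ImageIs g x′ y′ → ⊥
ImageIs-overlapping-disjoint a∈x a∈x′ y#y′ img img′ =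
  y#y′ (image-∈ img a∈x , image-∈ img′ a∈x′)

¬ΥFunctor-if-separates-overlap : ∀ A B f (pf : IsMor A B f) i j {a} →
  a ∈ elt A i → a ∈ elt A j → Disjoint (elt B (f i)) (elt B (f j)) →
  ¬ ΥFunctor
¬ΥFunctor-if-separates-overlap A B f pf i j a∈i a∈j fi#fj F =
  ImageIs-overlapping-disjoint a∈i a∈j fi#fj (image A B f pf i) (image A B f pf j)
  where open ΥFunctor F

pair : List ℕ → List ℕ → Fin 2 → List ℕ
pair x y zero    = x
pair x y (suc _) = y

pair-inj : ∀ {x y b} → b ∉ x → b ∈ y → ∀ i j → pair x y i ≐ pair x y j → i ≡ j
pair-inj b∉x b∈y zero       zero       _   = refl
pair-inj b∉x b∈y zero       (suc zero) x≐y = ⊥-elim (b∉x (proj₂ (x≐y _) b∈y))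
pair-inj b∉x b∈y (suc zero) zero       y≐x = ⊥-elim (b∉x (proj₁ (y≐x _) b∈y))
pair-inj b∉x b∈y (suc zero) (suc zero) _   = refl

partlessPair : (x y : List ℕ) {b : ℕ} → b ∉ x → b ∈ y → Obj
partlessPair x y b∉x b∈y = record
  { size = 2 ; elt = pair x y ; elt-inj = pair-inj b∉x b∈y ; parts = [] }

IsMor-partless : ∀ A B f → parts A ≡ [] → IsMor A B f
IsMor-partless A B f noParts p p∈parts = ⊥-elim (∉[] (subst (p ∈_) noParts p∈parts))

1∉[0] : 1 ∉ 0 ∷ []
1∉[0] (here ())
1∉[0] (there ())

3∉[2] : 3 ∉ 2 ∷ []
3∉[2] (here ())
3∉[2] (there ())

[2]#[3] : Disjoint (2 ∷ []) (3 ∷ [])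
[2]#[3] (here refl , here ())
[2]#[3] (here refl , there ())
[2]#[3] (there () , _)

overlappingPair : Obj
overlappingPair = partlessPair (0 ∷ []) (0 ∷ 1 ∷ []) 1∉[0] (there (here refl))

disjointPair : Obj
disjointPair = partlessPair (2 ∷ []) (3 ∷ []) 3∉[2] (here refl)

mainTheorem16 : ¬ ΥFunctor
mainTheorem16 =
  ¬ΥFunctor-if-separates-overlap overlappingPair disjointPair id
    (IsMor-partless overlappingPair disjointPair id refl)
    zero (suc zero) (here refl) (here refl) [2]#[3]
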